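{- Let $G$ be a finite connected undirected unweighted graph with node set $V$ and let $r$ be a ranking of $V$. Algorithm R (described in the context) run on $(G,r)$ terminates and outputs the radius $\mathrm{rad}(G)$, a center $c$ of $G$ (a node with $e(c)=\mathrm{rad}(G)$), and a radius certificate $L$ with $L\subseteq a_r(V)$, having performed at most $2|L|+1=O(|a_r(V)|)$ one-to-all distance queries.
   Context: $d$ is shortest-path distance, $e(u)=\max_v d(u,v)$, $\mathrm{rad}(G)=\min_u e(u)$. A ranking $r$ is an injective map $V\to\mathbb{N}$; the antipode $a_r(u)$ is the node $v$ maximizing $(d(u,v),r(v))$ lexicographically; $a_r(W)=\{a_r(u):u\in W\}$. For $L\subseteq V$, $e_L(u)=\max_{x\in L}d(u,x)$ (equal to $0$ if $L=\emptyset$); $L$ is a radius certificate if $e_L(u)\ge\mathrm{rad}(G)$ for all $u$. A one-to-all distance query from $u$ returns $(d(u,v))_{v\in V}$. Algorithm R: maintain $L$ (initially $\emptyset$), the values $e_L(v)$ for all $v$, and a set $K$ (initially $\emptyset$) with the known eccentricities of its elements. Each iteration: (1) choose $u\in V$ with $e_L(u)$ minimum (ties arbitrary); (2) query distances from $u$ and compute $e(u)$; (3) if $e(u)=e_L(u)$, output $(e(u),u,L)$ and halt; (4) otherwise let $a=a_r(u)$, query distances from $a$, add $u$ to $K$ and $a$ to $L$, and update $e_L(v):=\max(e_L(v),d(a,v))$. After each iteration, if $\min_{v\in V}e_L(v)\ge \min_{w\in K}e(w)$, halt and output $(e(c),c,L)$ where $c\in K$ minimizes $e(c)$; otherwise perform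 another iteration. -}

module Defs where

open import Data.Nat using (ℕ; zero; suc; _+_; _*_; _≤_; _<_; _⊔_; _⊓_; _≡ᵇ_; _≤ᵇ_)
open import Data.Fin using (Fin)
open import Data.List using (List; []; _∷_; map; foldr; allFin)
open import Data.List.Membership.Propositional using (_∈_)
open import Data.Maybe using (Maybe; just; nothing)
open import Data.Product using (_×_; ∃)
open import Data.Sum using (_⊎_)
open import Data.Bool using (if_then_else_)
open import Relation.Binary.PropositionalEquality using (_≡_)

Rel : ℕ → Set₁
Rel n = Fin (suc n) → Fin (suc n) → Set

Symmetric : ∀ {n} → Rel n → Set
Symmetric {n} E = ∀ {u v : Fin (suc n)} → E u v → E v u

Irreflexive : ∀ {n} → Rel n → Set
Irreflexive {n} E = ∀ {u : Fin (suc n)} → E u u → Data.Empty.⊥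
  where import Data.Empty

data Walk {n} (E : Rel n) : Fin (suc n) → Fin (suc n) → ℕ → Set where
  nil  : ∀ {u} → Walk E u u 0
  cons : ∀ {u w v k} → E u w → Walk E w v k → Walk E u v (suc k)

Connected : ∀ {n} → Rel n → Set
Connected {n} E = ∀ (u v : Fin (suc n)) → ∃ λ k → Walk E u v k

IsShortestPathDist : ∀ {n} → Rel n → (Fin (suc n) → Fin (suc n) → ℕ) → Set
IsShortestPathDist {n} E d =
  ∀ (u v : Fin (suc n)) → Walk E u v (d u v) × (∀ k → Walk E u v k → d u v ≤ k)

IsRanking : ∀ {n} → (Fin (suc n) → ℕ) → Set
IsRanking {n} r = ∀ {u v : Fin (suc n)} → r u ≡ r v → u ≡ v

LexLe : ℕ → ℕ → ℕ → ℕ → Set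
LexLe a b c e = a < c ⊎ (a ≡ c × b ≤ e)

IsAntipode : ∀ {n} → (Fin (suc n) → Fin (suc n) → ℕ) → (Fin (suc n) → ℕ)
           → (Fin (suc n) → Fin (suc n)) → Set
IsAntipode {n} d r ant = ∀ (u v : Fin (suc n)) → LexLe (d u v) (r v) (d u (ant u)) (r (ant u))

module Ecc {n : ℕ} (d : Fin (suc n) → Fin (suc n) → ℕ) where

  V : Set
  V = Fin (suc n)

  nodes : List V
  nodes = allFin (suc n)

  ecc : V → ℕ
  ecc u = foldr _⊔_ 0 (map (d u) nodes)

  -- e_L(u) = max_{x ∈ L} d(u,x), and 0 if L = ∅
  eccL : List V → V → ℕ
  eccL L u = foldr _⊔_ 0 (map (d u) L)

  minV : (V → ℕ) → ℕ
  minV f = foldr _⊓_ (f Data.Fin.zero) (map f nodes)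

  rad : ℕ
  rad = minV ecc

  IsRadiusCertificate : List V → Set
  IsRadiusCertificate L = ∀ (u : V) → rad ≤ eccL L u

  minK : V → List V → ℕ
  minK w K = foldr _⊓_ (ecc w) (map ecc K)

  -- tie-breaking oracle for step (1): may depend on the whole history (K, L)
  IsMinChooser : (List V → List V → V) → Set
  IsMinChooser choose = ∀ (K L : List V) (v : V) → eccL L (choose K L) ≤ eccL L v

  -- tie-breaking oracle for the final output: a minimizer of e in the nonempty list w ∷ K
  IsKPicker : (V → List V → V) → Set
  IsKPicker pick = ∀ (w : V) (K : List V) →
    pick w K ∈ (w ∷ K) × (∀ x → x ∈ (w ∷ K) → ecc (pick w K) ≤ ecc x)

record Output (n : ℕ) : Set where
  constructor output
  field
    radius  : ℕ
    center  : Fin (suc n)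
    cert    : List (Fin (suc n))
    queries : ℕ          -- number of one-to-all distance queries performed

module AlgorithmR {n : ℕ} (d : Fin (suc n) → Fin (suc n) → ℕ)
                  (ant : Fin (suc n) → Fin (suc n))
                  (choose : List (Fin (suc n)) → List (Fin (suc n)) → Fin (suc n))
                  (pick : Fin (suc n) → List (Fin (suc n)) → Fin (suc n)) where
  open Ecc d

  -- state: K (list of nodes with known eccentricity), L, number q of queries so far.
  -- Values e_L(v) are recomputed from L (they equal the maintained values).
  run : ℕ → List V → List V → ℕ → Maybe (Output n)
  run zero    K L q = nothing
  run (suc f) K L q =
    let u = choose K L in
    -- (2): one query from u
    if ecc u ≡ᵇ eccL L u
      then just (output (ecc u) u L (suc q))
      else                                                   -- (4): one query from a
        (let a  = ant u
             K' = u ∷ K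
             L' = a ∷ L
             c  = pick u K
         in if minK u K ≤ᵇ minV (eccL L')
              then just (output (ecc c) c L' (suc (suc q)))
              else run f K' L' (suc (suc q)))

  runFromStart : ℕ → Maybe (Output n)
  runFromStart f = run f [] [] 0

module Submission where

open import Defs
open import Data.Nat using (ℕ; zero; suc; _+_; _*_; _≤_; _<_; _⊔_; _⊓_; _≡ᵇ_; _≤ᵇ_; z≤n; s≤s)
open import Data.Nat.Properties
open import Data.Fin using (Fin; zero; suc) renaming (_<_ to _<ᶠ_)
import Data.Fin.Properties as Fin
open import Data.List using (List; []; _∷_; length; map; foldr; lookup)
open import Data.List.Membership.Propositional using (_∈_; _∉_)
open import Data.List.Membership.Propositional.Properties using (∈-lookup; ∈-allFin)
open import Data.List.Relation.Unary.Any using (here; there)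
open import Data.List.Relation.Unary.All as All using ()
open import Data.List.Relation.Unary.All.Properties.Core using (¬Any⇒All¬)
open import Data.List.Relation.Unary.Unique.Propositional using (Unique; []; _∷_)
open import Data.Maybe using (just)
open import Data.Bool using (true; false)
open import Data.Product using (_×_; _,_; ∃; Σ; proj₂)
open import Data.Sum using (inj₁; inj₂)
open import Relation.Nullary using (¬_; contradiction)
open import Relation.Nullary.Reflects using (Reflects; ofʸ; ofⁿ; fromEquivalence)
open import Relation.Binary.PropositionalEquality using (_≡_; refl; sym; trans; cong; subst)

-- The node u chosen in a round minimises e_L, and e_L ≤ e pointwise, so
-- min_v e_L(v) ≤ rad.  Hence any c with e(c) ≤ min_v e_L(v) (in particular u
-- itself when e(u) = e_L(u)) is a center, and L is a radius certificate.
-- Otherwise e_L(u) < e(u) ≤ d(u, a(u)), so the antipode a(u) is new to L: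
-- every round enlarges L by a fresh node, so there are at most |V| rounds and
-- two queries per element of L plus the final one.

≡ᵇ-reflects-≡ : ∀ m n → Reflects (m ≡ n) (m ≡ᵇ n)
≡ᵇ-reflects-≡ m n = fromEquivalence (≡ᵇ⇒≡ m n) (≡⇒≡ᵇ m n)

module _ {A : Set} (g : A → ℕ) where

  foldr-⊔-lub : ∀ xs {b} → (∀ {x} → x ∈ xs → g x ≤ b) → foldr _⊔_ 0 (map g xs) ≤ b
  foldr-⊔-lub []       h = z≤n
  foldr-⊔-lub (x ∷ xs) h = ⊔-lub (h (here refl)) (foldr-⊔-lub xs (λ p → h (there p)))

  foldr-⊔-upper : ∀ {xs x} → x ∈ xs → g x ≤ foldr _⊔_ 0 (map g xs)
  foldr-⊔-upper (here refl) = m≤m⊔n _ _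
  foldr-⊔-upper (there p)   = ≤-trans (foldr-⊔-upper p) (m≤n⊔m _ _)

  foldr-⊓-glb : ∀ xs {e b} → b ≤ e → (∀ {x} → x ∈ xs → b ≤ g x) → b ≤ foldr _⊓_ e (map g xs)
  foldr-⊓-glb []       b≤e h = b≤e
  foldr-⊓-glb (x ∷ xs) b≤e h = ⊓-glb (h (here refl)) (foldr-⊓-glb xs b≤e (λ p → h (there p)))

  foldr-⊓-lower : ∀ {xs e x} → x ∈ xs → foldr _⊓_ e (map g xs) ≤ g x
  foldr-⊓-lower (here refl) = m⊓n≤m _ _
  foldr-⊓-lower (there p)   = ≤-trans (m⊓n≤n _ _) (foldr-⊓-lower p)

Unique⇒lookup-injective : ∀ {A : Set} {xs : List A} → Unique xs →
                          ∀ {i j} → i <ᶠ j → ¬ lookup xs i ≡ lookup xs j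
Unique⇒lookup-injective {xs = _ ∷ _} (x∉xs ∷ _) {zero}  {suc j} _ = All.lookup x∉xs (∈-lookup j)
Unique⇒lookup-injective {xs = _ ∷ _} (_ ∷ u)    {suc i} {suc j} (s≤s i<j) =
  Unique⇒lookup-injective u i<j

Unique⇒length≤ : ∀ {m} {xs : List (Fin m)} → Unique xs → length xs ≤ m
Unique⇒length≤ {xs = xs} u = ≮⇒≥ λ m<length →
  let i , j , i<j , same = Fin.pigeonhole m<length (lookup xs)
  in  Unique⇒lookup-injective u i<j same

module EccProperties {n : ℕ} (d : Fin (suc n) → Fin (suc n) → ℕ) where
  open Ecc d

  minV≤ : ∀ f v → minV f ≤ f v
  minV≤ f v = foldr-⊓-lower f (∈-allFin v)

  ≤minV : ∀ f {b} → (∀ v → b ≤ f v) → b ≤ minV f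
  ≤minV f h = foldr-⊓-glb f nodes (h zero) (λ {v} _ → h v)

  eccL≤ecc : ∀ L v → eccL L v ≤ ecc v
  eccL≤ecc L v = foldr-⊔-lub (d v) L (λ {x} _ → foldr-⊔-upper (d v) (∈-allFin x))

  rad≤ecc : ∀ v → rad ≤ ecc v
  rad≤ecc = minV≤ ecc

  minV-eccL≤rad : ∀ L → minV (eccL L) ≤ rad
  minV-eccL≤rad L = ≤minV ecc λ v → ≤-trans (minV≤ (eccL L) v) (eccL≤ecc L v)

  certified-center : ∀ {c} L → ecc c ≤ minV (eccL L) → ecc c ≡ rad × IsRadiusCertificate L
  certified-center {c} L ecc≤ = ecc≡rad , λ v → begin
      rad            ≡⟨ sym ecc≡rad ⟩
      ecc c          ≤⟨ ecc≤ ⟩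
      minV (eccL L)  ≤⟨ minV≤ (eccL L) v ⟩
      eccL L v       ∎
    where
    open ≤-Reasoning
    ecc≡rad : ecc c ≡ rad
    ecc≡rad = ≤-antisym (≤-trans ecc≤ (minV-eccL≤rad L)) (rad≤ecc c)

  module _ (ant : V → V) (ant-farthest : ∀ u v → d u v ≤ d u (ant u)) where

    ecc≤d-ant : ∀ u → ecc u ≤ d u (ant u)
    ecc≤d-ant u = foldr-⊔-lub (d u) nodes (λ {v} _ → ant-farthest u v)

    ecc≢eccL⇒ant∉L : ∀ {L u} → ¬ ecc u ≡ eccL L u → ant u ∉ L
    ecc≢eccL⇒ant∉L {L} {u} ecc≢eccL ant∈L = ecc≢eccL
      (≤-antisym (≤-trans (ecc≤d-ant u) (foldr-⊔-upper (d u) ant∈L)) (eccL≤ecc L u))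

IsAntipode⇒farthest : ∀ {n d r ant} → IsAntipode {n} d r ant → ∀ u v → d u v ≤ d u (ant u)
IsAntipode⇒farthest antipode u v with antipode u v
... | inj₁ closer       = <⇒≤ closer
... | inj₂ (same , _)   = ≤-reflexive same

module Correctness {n : ℕ} (d : Fin (suc n) → Fin (suc n) → ℕ)
  (ant : Fin (suc n) → Fin (suc n)) (ant-farthest : ∀ u v → d u v ≤ d u (ant u))
  (choose : List (Fin (suc n)) → List (Fin (suc n)) → Fin (suc n)) (choose-min : Ecc.IsMinChooser d choose)
  (pick : Fin (suc n) → List (Fin (suc n)) → Fin (suc n)) (pick-min : Ecc.IsKPicker d pick) where
  open Ecc d
  open EccProperties d
  open AlgorithmR d ant choose pick

  IsCorrect : Output n → Set
  IsCorrect out = Output.radius out ≡ rad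
    × ecc (Output.center out) ≡ rad
    × IsRadiusCertificate (Output.cert out)
    × (∀ x → x ∈ Output.cert out → ∃ λ u → x ≡ ant u)
    × Unique (Output.cert out)
    × Output.queries out ≤ 2 * length (Output.cert out) + 1

  record Invariant (L : List V) (q : ℕ) : Set where
    field
      queries≡  : q ≡ 2 * length L
      unique    : Unique L
      antipodal : ∀ x → x ∈ L → ∃ λ u → x ≡ ant u
  open Invariant

  invariant-start : Invariant [] 0
  invariant-start = record { queries≡ = refl ; unique = [] ; antipodal = λ _ () }

  invariant-step : ∀ {L q u} → Invariant L q → ant u ∉ L → Invariant (ant u ∷ L) (2 + q)
  invariant-step {L} {u = u} inv ant∉L = record
    { queries≡  = trans (cong (2 +_) (queries≡ inv)) (sym (*-suc 2 (length L)))
    ; unique    = ¬Any⇒All¬ L ant∉L ∷ unique inv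
    ; antipodal = λ { x (here x≡ant) → u , x≡ant ; x (there x∈L) → antipodal inv x x∈L }
    }

  halting-correct : ∀ {L q q′ c} → Invariant L q → q′ ≤ q + 1 → ecc c ≤ minV (eccL L) →
                    IsCorrect (output (ecc c) c L q′)
  halting-correct {L} {q′ = q′} inv q′≤ ecc≤ =
    let ecc≡rad , certificate = certified-center L ecc≤ in
    ecc≡rad , ecc≡rad , certificate , antipodal inv , unique inv ,
    subst (λ m → q′ ≤ m + 1) (queries≡ inv) q′≤

  chosen-minimal : ∀ K L → eccL L (choose K L) ≤ minV (eccL L)
  chosen-minimal K L = ≤minV (eccL L) (choose-min K L)

  picked-minimal : ∀ u K → ecc (pick u K) ≤ minK u K
  picked-minimal u K = foldr-⊓-glb ecc K (minimal (here refl)) (λ x∈K → minimal (there x∈K))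
    where
    minimal : ∀ {x} → x ∈ u ∷ K → ecc (pick u K) ≤ ecc x
    minimal = proj₂ (pick-min u K) _

  run-correct : ∀ f K L q → Invariant L q → suc n < length L + f →
                Σ (Output n) λ out → run f K L q ≡ just out × IsCorrect out
  run-correct zero K L q inv fuel-left =
    contradiction (Unique⇒length≤ (unique inv)) (<⇒≱ (subst (suc n <_) (+-identityʳ _) fuel-left))
  run-correct (suc f) K L q inv fuel-left
    with ecc (choose K L) ≡ᵇ eccL L (choose K L) | ≡ᵇ-reflects-≡ (ecc (choose K L)) (eccL L (choose K L))
  ... | true | ofʸ tight =
    _ , refl , halting-correct inv (≤-reflexive (+-comm 1 q))
                 (≤-trans (≤-reflexive tight) (chosen-minimal K L))
  ... | false | ofⁿ loose
    with minK (choose K L) K ≤ᵇ minV (eccL (ant (choose K L) ∷ L))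
       | ≤ᵇ-reflects-≤ (minK (choose K L) K) (minV (eccL (ant (choose K L) ∷ L)))
  ...   | true | ofʸ stop =
    _ , refl , halting-correct inv′ (m≤m+n _ 1) (≤-trans (picked-minimal (choose K L) K) stop)
    where inv′ = invariant-step inv (ecc≢eccL⇒ant∉L ant ant-farthest loose)
  ...   | false | ofⁿ _ =
    run-correct f (choose K L ∷ K) (ant (choose K L) ∷ L) (2 + q) inv′
                (subst (suc n <_) (+-suc (length L) f) fuel-left)
    where inv′ = invariant-step inv (ecc≢eccL⇒ant∉L ant ant-farthest loose)

theorem3 : (n : ℕ) (E : Rel n) → Symmetric E → Irreflexive E → Connected E →
    (d : Fin (suc n) → Fin (suc n) → ℕ) → IsShortestPathDist E d →
    (r : Fin (suc n) → ℕ) → IsRanking r →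
    (ant : Fin (suc n) → Fin (suc n)) → IsAntipode d r ant →
    (choose : List (Fin (suc n)) → List (Fin (suc n)) → Fin (suc n)) → Ecc.IsMinChooser d choose →
    (pick : Fin (suc n) → List (Fin (suc n)) → Fin (suc n)) → Ecc.IsKPicker d pick →
    ∃ λ (fuel : ℕ) → Σ (Output n) λ out →
      AlgorithmR.runFromStart d ant choose pick fuel ≡ just out
      × Output.radius out ≡ Ecc.rad d
      × Ecc.ecc d (Output.center out) ≡ Ecc.rad d
      × Ecc.IsRadiusCertificate d (Output.cert out)
      × (∀ x → x ∈ Output.cert out → ∃ λ u → x ≡ ant u)
      × Unique (Output.cert out)
      × Output.queries out ≤ 2 * length (Output.cert out) + 1
theorem3 n _ _ _ _ d _ _ _ ant antipode choose choose-min pick pick-min =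
  2 + n , run-correct (2 + n) [] [] 0 invariant-start ≤-refl
  where open Correctness d ant (IsAntipode⇒farthest antipode) choose choose-min pick pick-min
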